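{- The scheme $\mathrm{Iab}_C\varphi\vee\mathrm{Iab}_C\neg\varphi$ is not valid: there exist a finite non-empty set of agents $N$, a coalition $C\subseteq N$, a formula $\varphi$, a coalition model $\mathcal{M}$ over $N$ and a state $s$ with $\mathcal{M},s\not\models\mathrm{Iab}_C\varphi$ and $\mathcal{M},s\not\models\mathrm{Iab}_C\neg\varphi$.
   Context: A coalition is any $C\subseteq N$, $\overline{C}=N\setminus C$. Formulas: $\varphi ::= p \mid \neg\varphi \mid (\varphi\wedge\psi) \mid [C]\varphi \mid \mathrm{Iab}_C\varphi$ over a countable set $\mathrm{Prop}$ of variables. A coalition model is $\mathcal{M}=(S,\{Act_i\}_{i\in N},o,V)$ with $S$ non-empty, each $Act_i$ non-empty, $o:S\times\prod_{i\in N}Act_i\to S$, $V:\mathrm{Prop}\to 2^S$; $Act_C=\prod_{i\in C}Act_i$ ($Act_\emptyset$ contains only the empty profile). $\mathcal{M},s\models[C]\varphi$ iff there is $\sigma_C\in Act_C$ such that for all $\sigma_{\overline{C}}\in Act_{\overline{C}}$, $\mathcal{M},o(s,\sigma_C,\sigma_{\overline{C}})\models\varphi$; $\mathcal{M},s\models\mathrm{Iab}_C\varphi$ iff $\mathcal{M},s\not\models[C]\varphi$; atoms and Boolean connectives as usual. -}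

module Defs where

open import Data.Nat using (ℕ; suc)
open import Data.Fin using (Fin)
open import Data.Bool using (Bool; true; false; T; not)
open import Data.Product using (Σ; _×_; _,_)
open import Data.Empty using (⊥)
open import Relation.Nullary using (¬_)

Coalition : ℕ → Set
Coalition n = Fin n → Bool

compl : ∀ {n} → Coalition n → Coalition n
compl C i = not (C i)

Var : Set
Var = ℕ

data Form (n : ℕ) : Set where
  var  : Var → Form n
  ¬'_  : Form n → Form n
  _∧'_ : Form n → Form n → Form n
  [_]_ : Coalition n → Form n → Form n
  Iab  : Coalition n → Form n → Form n

record Model (n : ℕ) : Set₁ where
  field
    S     : Set
    inhS  : S
    Act   : Fin n → Set
    inhAct : (i : Fin n) → Act i
    o     : S → ((i : Fin n) → Act i) → S
    V     : Var → S → Set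

  -- Act_C : partial profiles for coalition C (one action for each member of C)
  ActC : Coalition n → Set
  ActC C = (i : Fin n) → T (C i) → Act i

  combine : (C : Coalition n) → ActC C → ActC (compl C) → (i : Fin n) → Act i
  combine C σC σD i = pick (C i) (σC i) (σD i)
    where
      pick : (b : Bool) → (T b → Act i) → (T (not b) → Act i) → Act i
      pick true  f g = f _
      pick false f g = g _

open Model public

_,_⊨_ : ∀ {n} (M : Model n) → S M → Form n → Set
M , s ⊨ var p = V M p s
M , s ⊨ (¬' φ) = ¬ (M , s ⊨ φ)
M , s ⊨ (φ ∧' ψ) = (M , s ⊨ φ) × (M , s ⊨ ψ)
M , s ⊨ ([ C ] φ) =
  Σ (ActC M C) λ σC → (σD : ActC M (compl C)) → M , o M s (combine M C σC σD) ⊨ φ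
M , s ⊨ Iab C φ =
  ¬ (Σ (ActC M C) λ σC → (σD : ActC M (compl C)) → M , o M s (combine M C σC σD) ⊨ φ)

module Submission where

open import Defs
open import Data.Nat using (ℕ; suc)
open import Data.Fin using (zero)
open import Data.Bool using (Bool; true; false; T)
open import Data.Unit using (tt)
open import Data.Product using (Σ; _×_; _,_)
open import Relation.Nullary using (¬_)

-- A single agent who chooses the next state outright can force p and can force ¬p,
-- and Iab is the negation of ability, so neither Iab p nor Iab ¬p holds.

ability⇒¬Iab : ∀ {n} {M : Model n} {s : S M} {C : Coalition n} {φ : Form n} →
               M , s ⊨ ([ C ] φ) → ¬ (M , s ⊨ Iab C φ)
ability⇒¬Iab ability inability = inability ability

grand : ∀ {n} → Coalition n
grand _ = true

-- States are truth values of p, and the agent's action is the successor state.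
dictatorModel : Model 1
dictatorModel = record
  { S = Bool ; inhS = true
  ; Act = λ _ → Bool ; inhAct = λ _ → true
  ; o = λ _ σ → σ zero
  ; V = λ _ s → T s
  }

dictator-forces-p : ∀ s → dictatorModel , s ⊨ ([ grand ] var 0)
dictator-forces-p _ = (λ _ _ → true) , λ _ → tt

dictator-forces-¬p : ∀ s → dictatorModel , s ⊨ ([ grand ] (¬' var 0))
dictator-forces-¬p _ = (λ _ _ → false) , λ _ ()

theorem4p20 : Σ ℕ λ k → Σ (Coalition (suc k)) λ C → Σ (Form (suc k)) λ φ →
                Σ (Model (suc k)) λ M → Σ (S M) λ s →
                  (¬ (M , s ⊨ Iab C φ)) × (¬ (M , s ⊨ Iab C (¬' φ)))
theorem4p20 =
  0 , grand , var 0 , dictatorModel , true ,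
  ability⇒¬Iab {M = dictatorModel} {s = true} {φ = var 0} (dictator-forces-p true) ,
  ability⇒¬Iab {M = dictatorModel} {s = true} {φ = ¬' var 0} (dictator-forces-¬p true)
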